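{- Let $x$ be a word over $\Gamma$, and let $m\ge m(x)$ and $n\ge n(x)$ be integers. Then $u_x-u_{[x]_{m,n}}\in I$, i.e. $u_x$ and $u_{[x]_{m,n}}$ act identically on $\mathbf C[\mathbf Y]$.
   Context: A partition is a nonincreasing sequence of nonnegative integers with finite sum; $\lambda'$ is the conjugate ($\lambda'_i$ = number of boxes in column $i$). $\mathbf Y$ is the set of partitions, $\mathbf C[\mathbf Y]$ the vector space with basis $\mathbf Y$. $\Gamma=\{1,2,\dots\}\cup\{\bar1,\bar2,\dots\}$; $\mathcal U$ is the free associative $\mathbf C$-algebra on $u_a$, $a\in\Gamma$, $d_i=u_{\bar i}$, $u_x=u_{x_1}\cdots u_{x_\ell}$ for a word $x=x_1\cdots x_\ell$. $\mathcal U$ acts on $\mathbf C[\mathbf Y]$ (products as compositions): $u_i(\lambda)$ adds a box to column $i$ if the result is a partition, else $0$; $d_i(\lambda)$ removes a box from column $i$ if the result is a partition, else $0$. $I$ is the ideal of elements acting as zero. The weight has $w_i(x)$ = (number of $i$'s in $x$) $-$ (number of $\bar i$'s); $\alpha_i(x)=\max\{w_{i+1}(\tilde x)-w_i(\tilde x)\}$ over all suffixes $\tilde x$ of $x$ including the empty one. Define $m(x)=\max_{i\ge1}\{ -(\alpha_i(x)+w_i(x))\}$ (which is $\ge0$), $n(x)=\max\{t: t\text{ or }\bar t\text{ occurs in }x\}$, and for $m\ge m(x)$, $n\ge n(x)$, with $\beta^m_i(x)=\alpha_i(x)+w_i(x)+m$, \[ [x]_{m,n}=(\bar1^{m}\bar2^{m}\cdots\bar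 n^{m})\,(n^{\beta^m_n(x)}\,\bar n^{\alpha_n(x)}\,(n-1)^{\beta^m_{n-1}(x)}\,\overline{(n-1)}^{\alpha_{n-1}(x)}\cdots 1^{\beta^m_1(x)}\,\bar1^{\alpha_1(x)}), \] where $a^k$ denotes the letter $a$ repeated $k$ times. -}

module Defs where

open import Data.Nat as ℕ using (ℕ; zero; suc; _<_; _≥_)
open import Data.Integer as ℤ using (ℤ; +_; _-_; _⊔_; ∣_∣)
open import Data.List using (List; []; _∷_; _++_; replicate; reverse; concatMap; upTo; downFrom; tails; foldr)
open import Data.List.Relation.Unary.All using (All)
open import Data.List.Relation.Unary.All as All using ()
open import Data.List.Relation.Unary.Linked using (Linked)
open import Data.List.Relation.Unary.Linked as Linked using ()
open import Data.Maybe using (Maybe; just; nothing; _>>=_)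
open import Data.Product using (_×_)
open import Relation.Nullary using (Dec; yes; no)
open import Relation.Nullary.Decidable using (_×-dec_)
open import Data.Bool using (Bool; true; false; if_then_else_)

-- Convention: `num k` is the letter (k+1) and `bar k` is the letter
-- \overline{k+1}; so index k : ℕ corresponds to i = k+1 ≥ 1.
-- u_{num k} = u_{k+1},  u_{bar k} = d_{k+1}.

data Γ : Set where
  num : ℕ → Γ
  bar : ℕ → Γ

Word : Set
Word = List Γ

-- Partitions (Young diagrams), recorded by their column lengths
-- λ'_1 ≥ λ'_2 ≥ ... > 0 (list position k = column k+1).
-- λ ↦ λ' is a bijection of 𝐘, and the operators u_i, d_i are defined
-- column-wise, so we index Young diagrams by this column list.

IsPartition : List ℕ → Set
IsPartition L = Linked _≥_ L × All (0 <_) L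

isPartition? : (L : List ℕ) → Dec (IsPartition L)
isPartition? L = Linked.linked? ℕ._≥?_ L ×-dec All.all? (0 ℕ.<?_) L

validate : List ℕ → Maybe (List ℕ)
validate L with isPartition? L
... | yes _ = just L
... | no  _ = nothing

-- add one box to column k+1 (padding with empty columns if needed;
-- padded empty columns make the result fail `validate`)
incAt : ℕ → List ℕ → List ℕ
incAt zero    []       = 1 ∷ []
incAt (suc k) []       = 0 ∷ incAt k []
incAt zero    (c ∷ cs) = suc c ∷ cs
incAt (suc k) (c ∷ cs) = c ∷ incAt k cs

decAt : ℕ → List ℕ → Maybe (List ℕ)
decAt _       []             = nothing
decAt zero    (zero ∷ cs)    = nothing
decAt zero    (suc c ∷ cs)   = just (c ∷ cs)
decAt (suc k) (c ∷ cs)       with decAt k cs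
... | just cs' = just (c ∷ cs')
... | nothing  = nothing

-- drop trailing empty columns (a column emptied by d_i)
isZero : ℕ → Bool
isZero zero    = true
isZero (suc _) = false

stripTrailing : List ℕ → List ℕ
stripTrailing [] = []
stripTrailing (c ∷ cs) with stripTrailing cs
... | [] = if isZero c then [] else c ∷ []
... | r@(_ ∷ _) = c ∷ r

-- action of a single generator on a basis element (nothing = 0)
act : Γ → List ℕ → Maybe (List ℕ)
act (num k) L = validate (incAt k L)
act (bar k) L = decAt k L >>= λ L' → validate (stripTrailing L')

-- u_x = u_{x₁} ⋯ u_{x_ℓ} acting as a composition (x_ℓ acts first)
actWord : Word → List ℕ → Maybe (List ℕ)
actWord []      L = just L
actWord (a ∷ x) L = actWord x L >>= act a

-- Weights.  w k x = w_{k+1}(x).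

count : (Γ → Bool) → Word → ℕ
count p []      = 0
count p (a ∷ x) = if p a then suc (count p x) else count p x

isNum : ℕ → Γ → Bool
isNum k (num j) = j ℕ.≡ᵇ k
isNum k (bar _) = false

isBar : ℕ → Γ → Bool
isBar k (num _) = false
isBar k (bar j) = j ℕ.≡ᵇ k

w : ℕ → Word → ℤ
w k x = + count (isNum k) x - + count (isBar k) x

-- α k x = α_{k+1}(x) = max over all suffixes (incl. empty) of w_{k+2} - w_{k+1}
maxℤ : List ℤ → ℤ
maxℤ = foldr _⊔_ (+ 0)

α : ℕ → Word → ℤ
α k x = maxℤ (Data.List.map (λ s → w (suc k) s - w k s) (tails x))

β : ℕ → ℕ → Word → ℤ
β m k x = α k x ℤ.+ w k x ℤ.+ + m

index : Γ → ℕ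
index (num k) = suc k
index (bar k) = suc k

bracket : ℕ → ℕ → Word → Word
bracket m n x =
  concatMap (λ k → replicate m (bar k)) (upTo n)
  ++ concatMap (λ k → replicate (∣ β m k x ∣) (num k) ++ replicate (∣ α k x ∣) (bar k))
               (downFrom n)

-- Read a partition λ through its column lengths λ'. Then u_i and d_i add resp. remove a box in
-- column i whenever the result is still a partition, so u_x λ ≠ 0 iff λ' + w(s) is nonincreasing
-- for every suffix s of x, i.e. iff α_k(x) ≤ λ'_k − λ'_{k+1} for all k, and then u_x λ has columns
-- λ' + w(x). The word [x]_{m,n} has the same weight as x. On λ, its blocks k^{β_k} k̄^{α_k}
-- (k = 1, …, n) first lower column k by α_k and then raise it to λ'_k + w_k(x) + m (β_k ≥ 0 as
-- m ≥ m(x)); afterwards d_n^m, …, d_1^m remove the surplus m. Every intermediate diagram is a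
-- partition exactly when α_k(x) ≤ λ'_k − λ'_{k+1} for k ≤ n, and for k > n this holds anyway since
-- α_k(x) = 0. So u_x λ and u_{[x]} λ vanish together, and otherwise both have columns λ' + w(x).

module Submission where

open import Defs
open import Data.Bool using (true; false; if_then_else_)
open import Data.Empty using (⊥-elim)
open import Data.Integer as ℤ using (ℤ; +_; -_; _+_; _-_; ∣_∣; +≤+; 0ℤ; 1ℤ; -1ℤ) renaming (_≤_ to _≤ℤ_)
import Data.Integer.Properties as ℤP
open import Data.Integer.Tactic.RingSolver using (solve-∀)
open import Data.List using (List; []; _∷_; _++_; replicate; concatMap; upTo; downFrom; map; tails)
import Data.List.Properties as ListP
open import Data.List.Relation.Unary.All using (All; []; _∷_)
open import Data.List.Relation.Unary.Linked using (Linked; []; [-]; _∷_)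
open import Data.Maybe using (Maybe; just; nothing; _>>=_)
open import Data.Nat as ℕ using (ℕ; zero; suc; _≤_; _<_; _≥_; _≟_; _≡ᵇ_; z≤n; s≤s)
import Data.Nat.Properties as ℕP
open import Data.Product using (_×_; _,_; proj₁; proj₂; ∃)
open import Function using (_∘_)
open import Relation.Binary.PropositionalEquality
open import Relation.Nullary using (yes; no)

col : List ℕ → ℕ → ℕ
col []       _       = 0
col (c ∷ cs) zero    = c
col (c ∷ cs) (suc i) = col cs i

ColumnsAntitone : List ℕ → Set
ColumnsAntitone L = ∀ i → col L (suc i) ≤ col L i

partition⇒columnsAntitone : ∀ {L} → IsPartition L → ColumnsAntitone L
partition⇒columnsAntitone {[]}         _                     _       = z≤n
partition⇒columnsAntitone {c ∷ []}     _                     _       = z≤n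
partition⇒columnsAntitone {c ∷ d ∷ ds} (c≥d ∷ _  , _)        zero    = c≥d
partition⇒columnsAntitone {c ∷ d ∷ ds} (_   ∷ lk , _ ∷ pos) (suc i) =
  partition⇒columnsAntitone (lk , pos) i

columnsAntitone⇒linked : ∀ {L} → ColumnsAntitone L → Linked _≥_ L
columnsAntitone⇒linked {[]}         _    = []
columnsAntitone⇒linked {c ∷ []}     _    = [-]
columnsAntitone⇒linked {c ∷ d ∷ ds} anti = anti 0 ∷ columnsAntitone⇒linked (anti ∘ suc)

col-injective : ∀ {L L'} → All (0 <_) L → All (0 <_) L' → (∀ i → col L i ≡ col L' i) → L ≡ L'
col-injective {[]}     {[]}     _        _        _  = refl
col-injective {[]}     {_ ∷ _}  _        (p ∷ _)  eq = ⊥-elim (ℕP.<-irrefl (eq 0) p)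
col-injective {_ ∷ _}  {[]}     (p ∷ _)  _        eq = ⊥-elim (ℕP.<-irrefl (sym (eq 0)) p)
col-injective {_ ∷ _}  {_ ∷ _}  (_ ∷ ps) (_ ∷ qs) eq =
  cong₂ _∷_ (eq 0) (col-injective ps qs (eq ∘ suc))

validate-partition : ∀ {L} → IsPartition L → validate L ≡ just L
validate-partition {L} p with isPartition? L
... | yes _ = refl
... | no ¬p = ⊥-elim (¬p p)

validate-just : ∀ L {L'} → validate L ≡ just L' → L ≡ L' × IsPartition L
validate-just L eq with isPartition? L
validate-just L refl | yes p = refl , p
validate-just L ()   | no _

col-incAt-≡ : ∀ k L → col (incAt k L) k ≡ suc (col L k)
col-incAt-≡ zero    []       = refl
col-incAt-≡ (suc k) []       = col-incAt-≡ k []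
col-incAt-≡ zero    (c ∷ cs) = refl
col-incAt-≡ (suc k) (c ∷ cs) = col-incAt-≡ k cs

col-incAt-≢ : ∀ k L i → i ≢ k → col (incAt k L) i ≡ col L i
col-incAt-≢ zero    []       zero    i≢k = ⊥-elim (i≢k refl)
col-incAt-≢ zero    []       (suc i) _   = refl
col-incAt-≢ (suc k) []       zero    _   = refl
col-incAt-≢ (suc k) []       (suc i) i≢k = col-incAt-≢ k [] i (i≢k ∘ cong suc)
col-incAt-≢ zero    (c ∷ cs) zero    i≢k = ⊥-elim (i≢k refl)
col-incAt-≢ zero    (c ∷ cs) (suc i) _   = refl
col-incAt-≢ (suc k) (c ∷ cs) zero    _   = refl
col-incAt-≢ (suc k) (c ∷ cs) (suc i) i≢k = col-incAt-≢ k cs i (i≢k ∘ cong suc)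

CanAddBox : ℕ → List ℕ → Set
CanAddBox k L = ∀ j → k ≡ suc j → col L k < col L j

incAt-positive : ∀ k L → All (0 <_) L → CanAddBox k L → All (0 <_) (incAt k L)
incAt-positive zero    []       _        _   = s≤s z≤n ∷ []
incAt-positive zero    (c ∷ cs) (_ ∷ ps) _   = s≤s z≤n ∷ ps
incAt-positive (suc k) []       _        can = ⊥-elim (ℕP.<-irrefl refl (can k refl))
incAt-positive (suc k) (c ∷ cs) (p ∷ ps) can = p ∷ incAt-positive k cs ps (λ j → can (suc j) ∘ cong suc)

incAt-antitone : ∀ k L → ColumnsAntitone L → CanAddBox k L → ColumnsAntitone (incAt k L)
incAt-antitone k L anti can i with i ≟ k
... | yes refl = subst₂ _≤_ (sym (col-incAt-≢ i L (suc i) ℕP.1+n≢n)) (sym (col-incAt-≡ i L))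
                   (ℕP.m≤n⇒m≤1+n (anti i))
... | no i≢k with suc i ≟ k
...   | yes refl = subst₂ _≤_ (sym (col-incAt-≡ (suc i) L)) (sym (col-incAt-≢ (suc i) L i i≢k)) (can i refl)
...   | no si≢k  = subst₂ _≤_ (sym (col-incAt-≢ k L (suc i) si≢k)) (sym (col-incAt-≢ k L i i≢k)) (anti i)

act-num≡incAt : ∀ k L → IsPartition L → CanAddBox k L → act (num k) L ≡ just (incAt k L)
act-num≡incAt k L p@(_ , pos) can = validate-partition
  ( columnsAntitone⇒linked (incAt-antitone k L (partition⇒columnsAntitone p) can)
  , incAt-positive k L pos can)

act-num-just : ∀ k L {L'} → act (num k) L ≡ just L' → L' ≡ incAt k L × IsPartition L'
act-num-just k L eq with validate-just (incAt k L) eq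
... | refl , p = refl , p

BoxRemoved : ℕ → List ℕ → List ℕ → Set
BoxRemoved k L L' = col L k ≡ suc (col L' k) × (∀ i → i ≢ k → col L' i ≡ col L i)

decAt-just : ∀ k L {L'} → decAt k L ≡ just L' → BoxRemoved k L L'
decAt-just zero (suc c ∷ cs) refl = refl , λ { zero i≢0 → ⊥-elim (i≢0 refl) ; (suc i) _ → refl }
decAt-just (suc k) (c ∷ cs) eq with decAt k cs in e
decAt-just (suc k) (c ∷ cs) refl | just cs' =
  proj₁ (decAt-just k cs e) , λ { zero _ → refl ; (suc i) i≢k → proj₂ (decAt-just k cs e) i (i≢k ∘ cong suc) }

decAt-defined : ∀ k L → 0 < col L k → ∃ λ L' → decAt k L ≡ just L'
decAt-defined zero    (suc c ∷ cs) _   = _ , refl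
decAt-defined (suc k) (c ∷ cs)     pos with decAt k cs | decAt-defined k cs pos
... | just _ | _ = _ , refl

col-stripTrailing : ∀ L i → col (stripTrailing L) i ≡ col L i
col-stripTrailing []       i = refl
col-stripTrailing (c ∷ cs) i with stripTrailing cs | col-stripTrailing cs
col-stripTrailing (zero  ∷ cs) zero    | [] | _  = refl
col-stripTrailing (zero  ∷ cs) (suc i) | [] | ih = ih i
col-stripTrailing (suc c ∷ cs) zero    | [] | _  = refl
col-stripTrailing (suc c ∷ cs) (suc i) | [] | ih = ih i
col-stripTrailing (c ∷ cs)     zero    | _ ∷ _ | _  = refl
col-stripTrailing (c ∷ cs)     (suc i) | _ ∷ _ | ih = ih i

stripTrailing-positive : ∀ L → ColumnsAntitone L → All (0 <_) (stripTrailing L)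
stripTrailing-positive []       _    = []
stripTrailing-positive (c ∷ cs) anti
  with stripTrailing cs | col-stripTrailing cs | stripTrailing-positive cs (anti ∘ suc)
... | []    | _  | _ with c
...   | zero  = []
...   | suc _ = s≤s z≤n ∷ []
stripTrailing-positive (c ∷ cs) anti | r ∷ rs | col≡ | p ∷ ps =
  ℕP.<-≤-trans p (subst (_≤ c) (sym (col≡ 0)) (anti 0)) ∷ p ∷ ps

act-bar-just : ∀ k L {L'} → act (bar k) L ≡ just L' → IsPartition L' × BoxRemoved k L L'
act-bar-just k L eq with decAt k L in e
... | just L₀ with validate-just (stripTrailing L₀) eq | decAt-just k L e
...   | refl , p | removedₖ , removedᵢ =
  p , trans removedₖ (cong suc (sym (col-stripTrailing L₀ k))) ,
  λ i i≢k → trans (col-stripTrailing L₀ i) (removedᵢ i i≢k)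

act-bar-defined-col : ∀ k L → IsPartition L → col L (suc k) < col L k → ∃ λ L' → act (bar k) L ≡ just L'
act-bar-defined-col k L p lt with decAt-defined k L (ℕP.<-≤-trans (s≤s z≤n) lt)
... | L₀ , e with decAt-just k L e
...   | removedₖ , removedᵢ = _ , result
  where
  anti₀ : ColumnsAntitone L₀
  anti₀ i with i ≟ k
  ... | yes refl = ℕP.≤-pred (subst₂ _<_ (sym (removedᵢ (suc i) ℕP.1+n≢n)) removedₖ lt)
  ... | no i≢k with suc i ≟ k
  ...   | yes refl = ℕP.<⇒≤ (subst₂ _≤_ removedₖ (sym (removedᵢ i i≢k)) (partition⇒columnsAntitone p i))
  ...   | no si≢k  = subst₂ _≤_ (sym (removedᵢ (suc i) si≢k)) (sym (removedᵢ i i≢k))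
                       (partition⇒columnsAntitone p i)
  result : act (bar k) L ≡ just (stripTrailing L₀)
  result rewrite e = validate-partition
    ( columnsAntitone⇒linked (λ i → subst₂ _≤_ (sym (col-stripTrailing L₀ (suc i)))
                                                (sym (col-stripTrailing L₀ i)) (anti₀ i))
    , stripTrailing-positive L₀ anti₀)

≤-by-slack : ∀ {a b c d} → a ≤ℤ b → b - a ≡ d - c → c ≤ℤ d
≤-by-slack a≤b slack = ℤP.0≤i-j⇒j≤i (subst (0ℤ ≤ℤ_) slack (ℤP.i≤j⇒0≤j-i a≤b))

≡ᵇ-refl : ∀ k → (k ≡ᵇ k) ≡ true
≡ᵇ-refl zero    = refl
≡ᵇ-refl (suc k) = ≡ᵇ-refl k

≡ᵇ-≢ : ∀ {j k} → j ≢ k → (j ≡ᵇ k) ≡ false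
≡ᵇ-≢ {zero}  {zero}  j≢k = ⊥-elim (j≢k refl)
≡ᵇ-≢ {zero}  {suc k} _   = refl
≡ᵇ-≢ {suc j} {zero}  _   = refl
≡ᵇ-≢ {suc j} {suc k} j≢k = ≡ᵇ-≢ (j≢k ∘ cong suc)

count-++ : ∀ p xs ys → count p (xs ++ ys) ≡ count p xs ℕ.+ count p ys
count-++ p []       ys = refl
count-++ p (a ∷ xs) ys with p a
... | true  = cong suc (count-++ p xs ys)
... | false = count-++ p xs ys

count-replicate : ∀ p r a → count p (replicate r a) ≡ (if p a then r else 0)
count-replicate p zero    a with p a
... | true  = refl
... | false = refl
count-replicate p (suc r) a with p a | count-replicate p r a
... | true  | ih = cong suc ih
... | false | ih = ih

w-++ : ∀ i p q → w i (p ++ q) ≡ w i p + w i q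
w-++ i p q
  rewrite count-++ (isNum i) p q | count-++ (isBar i) p q
        | ℤP.pos-+ (count (isNum i) p) (count (isNum i) q) | ℤP.pos-+ (count (isBar i) p) (count (isBar i) q) =
  regroup (+ count (isNum i) p) (+ count (isNum i) q) (+ count (isBar i) p) (+ count (isBar i) q)
  where
  regroup : ∀ a b c d → (a + b) - (c + d) ≡ (a - c) + (b - d)
  regroup = solve-∀

w-replicate-num-≡ : ∀ r k → w k (replicate r (num k)) ≡ + r
w-replicate-num-≡ r k
  rewrite count-replicate (isNum k) r (num k) | count-replicate (isBar k) r (num k) | ≡ᵇ-refl k =
  ℤP.+-identityʳ (+ r)

w-replicate-num-≢ : ∀ r {k i} → k ≢ i → w i (replicate r (num k)) ≡ 0ℤ
w-replicate-num-≢ r {k} {i} k≢i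
  rewrite count-replicate (isNum i) r (num k) | count-replicate (isBar i) r (num k) | ≡ᵇ-≢ k≢i = refl

w-replicate-bar-≡ : ∀ r k → w k (replicate r (bar k)) ≡ - + r
w-replicate-bar-≡ r k
  rewrite count-replicate (isNum k) r (bar k) | count-replicate (isBar k) r (bar k) | ≡ᵇ-refl k =
  ℤP.+-identityˡ (- + r)

w-replicate-bar-≢ : ∀ r {k i} → k ≢ i → w i (replicate r (bar k)) ≡ 0ℤ
w-replicate-bar-≢ r {k} {i} k≢i
  rewrite count-replicate (isNum i) r (bar k) | count-replicate (isBar i) r (bar k) | ≡ᵇ-≢ k≢i = refl

w-∷ : ∀ i a y → w i (a ∷ y) ≡ w i (a ∷ []) + w i y
w-∷ i a y = w-++ i (a ∷ []) y

w-num∷-≡ : ∀ k y → w k (num k ∷ y) ≡ 1ℤ + w k y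
w-num∷-≡ k y = trans (w-∷ k (num k) y) (cong (_+ w k y) (w-replicate-num-≡ 1 k))

w-num∷-≢ : ∀ {k i} y → k ≢ i → w i (num k ∷ y) ≡ w i y
w-num∷-≢ {k} {i} y k≢i =
  trans (w-∷ i (num k) y) (trans (cong (_+ w i y) (w-replicate-num-≢ 1 k≢i)) (ℤP.+-identityˡ (w i y)))

w-bar∷-≡ : ∀ k y → w k (bar k ∷ y) ≡ - 1ℤ + w k y
w-bar∷-≡ k y = trans (w-∷ k (bar k) y) (cong (_+ w k y) (w-replicate-bar-≡ 1 k))

w-bar∷-≢ : ∀ {k i} y → k ≢ i → w i (bar k ∷ y) ≡ w i y
w-bar∷-≢ {k} {i} y k≢i =
  trans (w-∷ i (bar k) y) (trans (cong (_+ w i y) (w-replicate-bar-≢ 1 k≢i)) (ℤP.+-identityˡ (w i y)))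

columns : List ℕ → ℕ → ℤ
columns L i = + col L i

HasColumns : List ℕ → (ℕ → ℤ) → Set
HasColumns L g = IsPartition L × columns L ≗ g

hasColumns-antitone : ∀ {L g} → HasColumns L g → ∀ i → g (suc i) ≤ℤ g i
hasColumns-antitone (p , eq) i = subst₂ _≤ℤ_ (eq (suc i)) (eq i) (+≤+ (partition⇒columnsAntitone p i))

hasColumns-unique : ∀ {L L' g} → HasColumns L g → HasColumns L' g → L ≡ L'
hasColumns-unique ((_ , pos) , eq) ((_ , pos') , eq') =
  col-injective pos pos' (λ i → ℤP.+-injective (trans (eq i) (sym (eq' i))))

+-suc : ∀ c → + suc c ≡ + c + 1ℤ
+-suc c = trans (cong +_ (ℕP.+-comm 1 c)) (ℤP.pos-+ c 1)

act-num-hasColumns : ∀ {L L' g} k → HasColumns L g → act (num k) L ≡ just L' →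
                     HasColumns L' (λ i → g i + w i (num k ∷ []))
act-num-hasColumns {L} {g = g} k (_ , eq) e with act-num-just k L e
... | refl , p = p , cols
  where
  cols : ∀ i → columns (incAt k L) i ≡ g i + w i (num k ∷ [])
  cols i with i ≟ k
  ... | yes refl = begin
    + col (incAt i L) i  ≡⟨ cong +_ (col-incAt-≡ i L) ⟩
    + suc (col L i)      ≡⟨ +-suc (col L i) ⟩
    + col L i + 1ℤ       ≡⟨ cong₂ _+_ (eq i) (sym (w-replicate-num-≡ 1 i)) ⟩
    g i + w i (num i ∷ []) ∎
    where open ≡-Reasoning
  ... | no i≢k = begin
    + col (incAt k L) i  ≡⟨ cong +_ (col-incAt-≢ k L i i≢k) ⟩
    + col L i            ≡⟨ eq i ⟩
    g i                  ≡⟨ sym (ℤP.+-identityʳ (g i)) ⟩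
    g i + 0ℤ             ≡⟨ cong (_+_ (g i)) (sym (w-replicate-num-≢ 1 (i≢k ∘ sym))) ⟩
    g i + w i (num k ∷ []) ∎
    where open ≡-Reasoning

act-bar-hasColumns : ∀ {L L' g} k → HasColumns L g → act (bar k) L ≡ just L' →
                     HasColumns L' (λ i → g i + w i (bar k ∷ []))
act-bar-hasColumns {L} {L'} {g} k (_ , eq) e with act-bar-just k L e
... | p , removedₖ , removedᵢ = p , cols
  where
  cols : ∀ i → columns L' i ≡ g i + w i (bar k ∷ [])
  cols i with i ≟ k
  ... | yes refl = begin
    + col L' i                 ≡⟨ add-sub (+ col L' i) ⟩
    (+ col L' i + 1ℤ) + -1ℤ    ≡⟨ cong (_+ -1ℤ) (sym (+-suc (col L' i))) ⟩
    + suc (col L' i) + -1ℤ     ≡⟨ cong (λ c → + c + -1ℤ) (sym removedₖ) ⟩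
    + col L i + -1ℤ            ≡⟨ cong₂ _+_ (eq i) (sym (w-replicate-bar-≡ 1 i)) ⟩
    g i + w i (bar i ∷ [])     ∎
    where
    open ≡-Reasoning
    add-sub : ∀ a → a ≡ (a + 1ℤ) + -1ℤ
    add-sub = solve-∀
  ... | no i≢k = begin
    + col L' i                 ≡⟨ cong +_ (removedᵢ i i≢k) ⟩
    + col L i                  ≡⟨ eq i ⟩
    g i                        ≡⟨ sym (ℤP.+-identityʳ (g i)) ⟩
    g i + 0ℤ                   ≡⟨ cong (_+_ (g i)) (sym (w-replicate-bar-≢ 1 (i≢k ∘ sym))) ⟩
    g i + w i (bar k ∷ [])     ∎
    where open ≡-Reasoning

act-num-defined : ∀ {L g} k → HasColumns L g → (∀ j → k ≡ suc j → 1ℤ + g k ≤ℤ g j) →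
                  ∃ λ L' → act (num k) L ≡ just L'
act-num-defined {L} {g} k (p , eq) room =
  incAt k L , act-num≡incAt k L p (λ j k≡1+j → ℤP.drop‿+≤+ (subst₂ _≤ℤ_
    (cong (_+_ 1ℤ) (sym (eq k))) (sym (eq j)) (room j k≡1+j)))

act-bar-defined : ∀ {L g} k → HasColumns L g → 1ℤ + g (suc k) ≤ℤ g k →
                  ∃ λ L' → act (bar k) L ≡ just L'
act-bar-defined {L} {g} k (p , eq) room = act-bar-defined-col k L p (ℤP.drop‿+≤+ (subst₂ _≤ℤ_
  (cong (_+_ 1ℤ) (sym (eq (suc k)))) (sym (eq k)) room))

>>=-just : ∀ {A B : Set} (m : Maybe A) {f : A → Maybe B} {b} →
           (m >>= f) ≡ just b → ∃ λ a → m ≡ just a × f a ≡ just b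
>>=-just (just a) e = a , refl , e

act-hasColumns : ∀ {L L' g} a → HasColumns L g → act a L ≡ just L' →
                 HasColumns L' (λ i → g i + w i (a ∷ []))
act-hasColumns (num k) = act-num-hasColumns k
act-hasColumns (bar k) = act-bar-hasColumns k

actWord-hasColumns : ∀ {L L' g} y → HasColumns L g → actWord y L ≡ just L' →
                     HasColumns L' (λ i → g i + w i y)
actWord-hasColumns [] (p , eq) refl = p , λ i → trans (eq i) (sym (ℤP.+-identityʳ _))
actWord-hasColumns {g = g} (a ∷ y) cols e with >>=-just (actWord y _) e
... | _ , e₁ , e₂ with act-hasColumns a (actWord-hasColumns y cols e₁) e₂
...   | p , eq = p , λ i → trans (eq i) (trans (reassoc (g i) (w i y) (w i (a ∷ [])))
                                              (cong (_+_ (g i)) (sym (w-∷ i a y))))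
  where
  reassoc : ∀ c u v → (c + u) + v ≡ c + (v + u)
  reassoc = solve-∀

sum-antitone⇒diff-≤-gap : ∀ (g h : ℕ → ℤ) k → g (suc k) + h (suc k) ≤ℤ g k + h k →
                          h (suc k) - h k ≤ℤ g k - g (suc k)
sum-antitone⇒diff-≤-gap g h k le = ≤-by-slack le (regroup (g (suc k)) (h (suc k)) (g k) (h k))
  where
  regroup : ∀ a b c d → (c + d) - (a + b) ≡ (c - a) - (b - d)
  regroup = solve-∀

diff-≤-gap⇒sum-antitone : ∀ (g h : ℕ → ℤ) k → h (suc k) - h k ≤ℤ g k - g (suc k) →
                          g (suc k) + h (suc k) ≤ℤ g k + h k
diff-≤-gap⇒sum-antitone g h k le = ≤-by-slack le (regroup (g (suc k)) (h (suc k)) (g k) (h k))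
  where
  regroup : ∀ a b c d → (c - a) - (b - d) ≡ (c + d) - (a + b)
  regroup = solve-∀

Admissible : Word → (ℕ → ℤ) → Set
Admissible y g = ∀ k → α k y ≤ℤ g k - g (suc k)

actWord-just⇒admissible : ∀ {L L' g} y → HasColumns L g → actWord y L ≡ just L' → Admissible y g
actWord-just⇒admissible [] cols refl k = ℤP.i≤j⇒0≤j-i (hasColumns-antitone cols k)
actWord-just⇒admissible {g = g} (a ∷ y) cols e k with >>=-just (actWord y _) e
... | _ , e₁ , _ = ℤP.⊔-lub
  (sum-antitone⇒diff-≤-gap g (λ i → w i (a ∷ y)) k (hasColumns-antitone (actWord-hasColumns (a ∷ y) cols e) k))
  (actWord-just⇒admissible y cols e₁ k)

admissible⇒actWord-defined : ∀ {L g} y → HasColumns L g → Admissible y g → ∃ λ L' → actWord y L ≡ just L'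
admissible⇒actWord-defined []               _    _   = _ , refl
admissible⇒actWord-defined {L} {g} (a ∷ y) cols adm
  with admissible⇒actWord-defined y cols (λ k → ℤP.i⊔j≤k⇒j≤k _ _ (adm k))
... | L₁ , e₁
  with last-step a (λ k → diff-≤-gap⇒sum-antitone g (λ i → w i (a ∷ y)) k (ℤP.i⊔j≤k⇒i≤k _ _ (adm k)))
  where
  cols₁ : HasColumns L₁ (λ i → g i + w i y)
  cols₁ = actWord-hasColumns y cols e₁
  last-step : ∀ a → (∀ k → g (suc k) + w (suc k) (a ∷ y) ≤ℤ g k + w k (a ∷ y)) →
              ∃ λ L' → act a L₁ ≡ just L'
  last-step (num k) anti = act-num-defined k cols₁ room
    where
    room : ∀ j → k ≡ suc j → 1ℤ + (g k + w k y) ≤ℤ g j + w j y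
    room j refl = subst₂ _≤ℤ_ (trans (cong (_+_ (g k)) (w-num∷-≡ k y)) (swap (g k) (w k y)))
                              (cong (_+_ (g j)) (w-num∷-≢ y ℕP.1+n≢n)) (anti j)
      where
      swap : ∀ c u → c + (1ℤ + u) ≡ 1ℤ + (c + u)
      swap = solve-∀
  last-step (bar k) anti = act-bar-defined k cols₁ room
    where
    room : 1ℤ + (g (suc k) + w (suc k) y) ≤ℤ g k + w k y
    room = subst₂ _≤ℤ_ (cong (λ v → 1ℤ + (g (suc k) + v)) (w-bar∷-≢ y (ℕP.1+n≢n ∘ sym)))
                       (trans (cong (λ v → 1ℤ + (g k + v)) (w-bar∷-≡ k y)) (cancel (g k) (w k y)))
                       (ℤP.+-monoʳ-≤ 1ℤ (anti k))
      where
      cancel : ∀ c u → 1ℤ + (c + (- 1ℤ + u)) ≡ c + u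
      cancel = solve-∀
... | L' , e = L' , trans (cong (_>>= act a) e₁) e

actWord-++-just : ∀ p q {L L₁ L₂} → actWord q L ≡ just L₁ → actWord p L₁ ≡ just L₂ →
                  actWord (p ++ q) L ≡ just L₂
actWord-++-just []      q e₁ refl = e₁
actWord-++-just (a ∷ p) q e₁ e₂ with >>=-just (actWord p _) e₂
... | _ , e₃ , e₄ rewrite actWord-++-just p q e₁ e₃ = e₄

actWord-++-just⁻¹ : ∀ p q {L L₂} → actWord (p ++ q) L ≡ just L₂ →
                    ∃ λ L₁ → actWord q L ≡ just L₁ × actWord p L₁ ≡ just L₂
actWord-++-just⁻¹ []      q e = _ , e , refl
actWord-++-just⁻¹ (a ∷ p) q e with >>=-just (actWord (p ++ q) _) e
... | _ , e₁ , e₂ with actWord-++-just⁻¹ p q e₁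
...   | L₁ , e₃ , e₄ = L₁ , e₃ , trans (cong (_>>= act a) e₄) e₂

replicate-num-defined : ∀ {L g} r k → HasColumns L g → (∀ j → k ≡ suc j → g k + + r ≤ℤ g j) →
                        ∃ λ L' → actWord (replicate r (num k)) L ≡ just L'
replicate-num-defined zero    k cols room = _ , refl
replicate-num-defined {g = g} (suc r) k cols room
  with replicate-num-defined r k cols
         (λ j k≡1+j → ℤP.≤-trans (ℤP.+-monoʳ-≤ (g k) (+≤+ (ℕP.n≤1+n r))) (room j k≡1+j))
... | L₁ , e₁ with act-num-defined k (actWord-hasColumns (replicate r (num k)) cols e₁) room₁
  where
  room₁ : ∀ j → k ≡ suc j → 1ℤ + (g k + w k (replicate r (num k))) ≤ℤ g j + w j (replicate r (num k))
  room₁ j refl = subst₂ _≤ℤ_ (trans (cong (_+_ (g k)) (+-suc r))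
                                    (trans (shuffle (g k) (+ r))
                                           (cong (λ u → 1ℤ + (g k + u)) (sym (w-replicate-num-≡ r k)))))
                             (sym (trans (cong (_+_ (g j)) (w-replicate-num-≢ r ℕP.1+n≢n)) (ℤP.+-identityʳ (g j))))
                             (room j refl)
    where
    shuffle : ∀ c u → c + (u + 1ℤ) ≡ 1ℤ + (c + u)
    shuffle = solve-∀
... | L' , e = L' , trans (cong (_>>= act (num k)) e₁) e

replicate-bar-defined : ∀ {L g} r k → HasColumns L g → g (suc k) + + r ≤ℤ g k →
                        ∃ λ L' → actWord (replicate r (bar k)) L ≡ just L'
replicate-bar-defined zero    k cols room = _ , refl
replicate-bar-defined {g = g} (suc r) k cols room
  with replicate-bar-defined r k cols (ℤP.≤-trans (ℤP.+-monoʳ-≤ (g (suc k)) (+≤+ (ℕP.n≤1+n r))) room)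
... | L₁ , e₁ with act-bar-defined k (actWord-hasColumns (replicate r (bar k)) cols e₁) room₁
  where
  room₁ : 1ℤ + (g (suc k) + w (suc k) (replicate r (bar k))) ≤ℤ g k + w k (replicate r (bar k))
  room₁ rewrite w-replicate-bar-≢ r {k} {suc k} (ℕP.1+n≢n ∘ sym) | w-replicate-bar-≡ r k =
    ≤-by-slack room (trans (cong (λ u → g k - (g (suc k) + u)) (+-suc r)) (regroup (g k) (g (suc k)) (+ r)))
    where
    regroup : ∀ c₀ c₁ u → c₀ - (c₁ + (u + 1ℤ)) ≡ (c₀ + - u) - (1ℤ + (c₁ + 0ℤ))
    regroup = solve-∀
... | L' , e = L' , trans (cong (_>>= act (bar k)) e₁) e

replicate-bar-just⇒room : ∀ {L L' g} r k → HasColumns L g → actWord (replicate r (bar k)) L ≡ just L' →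
                          g (suc k) + + r ≤ℤ g k
replicate-bar-just⇒room {g = g} r k cols e
  with hasColumns-antitone (actWord-hasColumns (replicate r (bar k)) cols e) k
... | anti rewrite w-replicate-bar-≢ r {k} {suc k} (ℕP.1+n≢n ∘ sym) | w-replicate-bar-≡ r k =
  ≤-by-slack anti (regroup (g k) (g (suc k)) (+ r))
  where
  regroup : ∀ c₀ c₁ u → (c₀ + - u) - (c₁ + 0ℤ) ≡ c₀ - (c₁ + u)
  regroup = solve-∀

hasColumns-cong : ∀ {L g h} → g ≗ h → HasColumns L g → HasColumns L h
hasColumns-cong g≗h (p , eq) = p , λ i → trans (eq i) (g≗h i)

partition-hasColumns : ∀ {L} → IsPartition L → HasColumns L (columns L)
partition-hasColumns p = p , λ _ → refl

maxℤ-nonneg : ∀ zs → 0ℤ ≤ℤ maxℤ zs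
maxℤ-nonneg []       = ℤP.≤-refl
maxℤ-nonneg (z ∷ zs) = ℤP.i≤j⇒i≤k⊔j z (maxℤ-nonneg zs)

α-nonneg : ∀ k y → 0ℤ ≤ℤ α k y
α-nonneg k y = maxℤ-nonneg (map (λ s → w (suc k) s - w k s) (tails y))

w-diff≤α : ∀ k y → w (suc k) y - w k y ≤ℤ α k y
w-diff≤α k y = ℤP.i≤i⊔j _ _

count-isNum-above : ∀ {n k} y → All (λ a → index a ≤ n) y → n ≤ k → count (isNum k) y ≡ 0
count-isNum-above []          []       _   = refl
count-isNum-above (num j ∷ y) (j<n ∷ bounded) n≤k
  rewrite ≡ᵇ-≢ {j} (ℕP.<⇒≢ (ℕP.<-≤-trans j<n n≤k)) = count-isNum-above y bounded n≤k
count-isNum-above (bar j ∷ y) (_ ∷ bounded) n≤k = count-isNum-above y bounded n≤k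

count-isBar-above : ∀ {n k} y → All (λ a → index a ≤ n) y → n ≤ k → count (isBar k) y ≡ 0
count-isBar-above []          []       _   = refl
count-isBar-above (bar j ∷ y) (j<n ∷ bounded) n≤k
  rewrite ≡ᵇ-≢ {j} (ℕP.<⇒≢ (ℕP.<-≤-trans j<n n≤k)) = count-isBar-above y bounded n≤k
count-isBar-above (num j ∷ y) (_ ∷ bounded) n≤k = count-isBar-above y bounded n≤k

w-above : ∀ {n k} y → All (λ a → index a ≤ n) y → n ≤ k → w k y ≡ 0ℤ
w-above y bounded n≤k rewrite count-isNum-above y bounded n≤k | count-isBar-above y bounded n≤k = refl

α-above : ∀ {n k} y → All (λ a → index a ≤ n) y → n ≤ k → α k y ≤ℤ 0ℤ
α-above []      _                 _   = ℤP.≤-refl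
α-above {k = k} (a ∷ y) bounded@(_ ∷ bounded′) n≤k
  rewrite w-above (a ∷ y) bounded (ℕP.m≤n⇒m≤1+n n≤k) | w-above {k = k} (a ∷ y) bounded n≤k =
  ℤP.⊔-lub ℤP.≤-refl (α-above y bounded′ n≤k)

-- bracket m n x is definitionally lowering m n ++ raising m x n, the paper's
-- (1̄^m ⋯ n̄^m)(n^{β_n} n̄^{α_n} ⋯ 1^{β_1} 1̄^{α_1}).
block : ℕ → Word → ℕ → Word
block m x k = replicate (∣ β m k x ∣) (num k) ++ replicate (∣ α k x ∣) (bar k)

raising : ℕ → Word → ℕ → Word
raising m x j = concatMap (block m x) (downFrom j)

lowering : ℕ → ℕ → Word
lowering m j = concatMap (λ k → replicate m (bar k)) (upTo j)

lowering-suc : ∀ m j → lowering m (suc j) ≡ lowering m j ++ replicate m (bar j)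
lowering-suc m j = begin
  concatMap bars (upTo (suc j))          ≡⟨ cong (concatMap bars) (sym (ListP.upTo-∷ʳ j)) ⟩
  concatMap bars (upTo j ++ j ∷ [])      ≡⟨ ListP.concatMap-++ bars (upTo j) (j ∷ []) ⟩
  lowering m j ++ bars j ++ []           ≡⟨ cong (lowering m j ++_) (ListP.++-identityʳ (bars j)) ⟩
  lowering m j ++ bars j                 ∎
  where
  open ≡-Reasoning
  bars : ℕ → Word
  bars k = replicate m (bar k)

+∣α∣ : ∀ k y → + ∣ α k y ∣ ≡ α k y
+∣α∣ k y = ℤP.0≤i⇒+∣i∣≡i (α-nonneg k y)

+∣β∣ : ∀ {m} k x → - (α k x + w k x) ≤ℤ + m → + ∣ β m k x ∣ ≡ β m k x
+∣β∣ {m} k x m-large = ℤP.0≤i⇒+∣i∣≡i (≤-by-slack m-large (regroup (α k x) (w k x) (+ m)))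
  where
  regroup : ∀ a u v → v - - (a + u) ≡ (a + u + v) - 0ℤ
  regroup = solve-∀

w-block-≡ : ∀ {m} k x → - (α k x + w k x) ≤ℤ + m → w k (block m x k) ≡ w k x + + m
w-block-≡ {m} k x m-large = begin
  w k (block m x k)                           ≡⟨ w-++ k (replicate (∣ β m k x ∣) (num k)) _ ⟩
  w k (replicate (∣ β m k x ∣) (num k)) + w k (replicate (∣ α k x ∣) (bar k))
    ≡⟨ cong₂ _+_ (w-replicate-num-≡ (∣ β m k x ∣) k) (w-replicate-bar-≡ (∣ α k x ∣) k) ⟩
  + ∣ β m k x ∣ + - + ∣ α k x ∣              ≡⟨ cong₂ (λ b a → b + - a) (+∣β∣ k x m-large) (+∣α∣ k x) ⟩
  (α k x + w k x + + m) + - α k x             ≡⟨ cancel (α k x) (w k x) (+ m) ⟩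
  w k x + + m                                 ∎
  where
  open ≡-Reasoning
  cancel : ∀ a u v → (a + u + v) + - a ≡ u + v
  cancel = solve-∀

w-block-≢ : ∀ m x {k i} → k ≢ i → w i (block m x k) ≡ 0ℤ
w-block-≢ m x {k} {i} k≢i rewrite w-++ i (replicate (∣ β m k x ∣) (num k)) (replicate (∣ α k x ∣) (bar k))
                                | w-replicate-num-≢ (∣ β m k x ∣) k≢i | w-replicate-bar-≢ (∣ α k x ∣) k≢i = refl

w-raising-≥ : ∀ m x j {i} → j ≤ i → w i (raising m x j) ≡ 0ℤ
w-raising-≥ m x zero    _   = refl
w-raising-≥ m x (suc j) {i} j<i
  rewrite w-++ i (block m x j) (raising m x j)
        | w-block-≢ m x (ℕP.<⇒≢ j<i) | w-raising-≥ m x j (ℕP.<⇒≤ j<i) = refl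

w-raising-< : ∀ {m} x → (∀ k → - (α k x + w k x) ≤ℤ + m) →
              ∀ j {i} → i < j → w i (raising m x j) ≡ w i x + + m
w-raising-< {m} x m-large (suc j) {i} i<1+j with i ≟ j
... | yes refl rewrite w-++ i (block m x i) (raising m x i)
                     | w-block-≡ i x (m-large i) | w-raising-≥ m x i ℕP.≤-refl = ℤP.+-identityʳ _
... | no i≢j   rewrite w-++ i (block m x j) (raising m x j)
                     | w-block-≢ m x (i≢j ∘ sym) =
  trans (ℤP.+-identityˡ _) (w-raising-< x m-large j (ℕP.≤∧≢⇒< (ℕP.≤-pred i<1+j) i≢j))

w-lowering-≥ : ∀ m j {i} → j ≤ i → w i (lowering m j) ≡ 0ℤ
w-lowering-≥ m zero    _   = refl
w-lowering-≥ m (suc j) {i} j<i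
  rewrite lowering-suc m j | w-++ i (lowering m j) (replicate m (bar j))
        | w-lowering-≥ m j (ℕP.<⇒≤ j<i) | w-replicate-bar-≢ m (ℕP.<⇒≢ j<i) = refl

w-lowering-< : ∀ m j {i} → i < j → w i (lowering m j) ≡ - + m
w-lowering-< m (suc j) {i} i<1+j with i ≟ j
... | yes refl rewrite lowering-suc m i | w-++ i (lowering m i) (replicate m (bar i))
                     | w-lowering-≥ m i (ℕP.≤-refl {i}) | w-replicate-bar-≡ m i = ℤP.+-identityˡ _
... | no i≢j   rewrite lowering-suc m j | w-++ i (lowering m j) (replicate m (bar j))
                     | w-replicate-bar-≢ m (i≢j ∘ sym) =
  trans (ℤP.+-identityʳ _) (w-lowering-< m j (ℕP.≤∧≢⇒< (ℕP.≤-pred i<1+j) i≢j))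

w-bracket : ∀ {m n} x → (∀ k → - (α k x + w k x) ≤ℤ + m) → All (λ a → index a ≤ n) x →
            ∀ i → w i (bracket m n x) ≡ w i x
w-bracket {m} {n} x m-large bounded i rewrite w-++ i (lowering m n) (raising m x n) with i ℕ.<? n
... | yes i<n rewrite w-lowering-< m n i<n | w-raising-< x m-large n i<n = cancel (w i x) (+ m)
  where
  cancel : ∀ u v → - v + (u + v) ≡ u
  cancel = solve-∀
... | no i≮n rewrite w-lowering-≥ m n (ℕP.≮⇒≥ i≮n) | w-raising-≥ m x n (ℕP.≮⇒≥ i≮n) =
  sym (w-above x bounded (ℕP.≮⇒≥ i≮n))

raising-just⇒gap : ∀ {m x L L' g} j → HasColumns L g → actWord (raising m x j) L ≡ just L' →
                   ∀ k → k < j → α k x ≤ℤ g k - g (suc k)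
raising-just⇒gap {m} {x} {g = g} (suc j) cols e k k<1+j
  with actWord-++-just⁻¹ (block m x j) (raising m x j) e
... | L₁ , e₁ , e₂ with k ≟ j
...   | no k≢j = raising-just⇒gap {m} {x} j cols e₁ k (ℕP.≤∧≢⇒< (ℕP.≤-pred k<1+j) k≢j)
...   | yes refl with actWord-++-just⁻¹ (replicate (∣ β m k x ∣) (num k)) (replicate (∣ α k x ∣) (bar k)) e₂
...     | _ , e₃ , _ with replicate-bar-just⇒room (∣ α k x ∣) k (actWord-hasColumns (raising m x k) cols e₁) e₃
...       | room rewrite w-raising-≥ m x k (ℕP.n≤1+n k) | w-raising-≥ m x k (ℕP.≤-refl {k}) | +∣α∣ k x =
  ≤-by-slack room (regroup (g k) (g (suc k)) (α k x))
  where
  regroup : ∀ c₀ c₁ a → (c₀ + 0ℤ) - ((c₁ + 0ℤ) + a) ≡ (c₀ - c₁) - a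
  regroup = solve-∀

bracket-just⇒admissible : ∀ {m n x L L' g} → All (λ a → index a ≤ n) x → HasColumns L g →
                          actWord (bracket m n x) L ≡ just L' → Admissible x g
bracket-just⇒admissible {m} {n} {x} bounded cols e k
  with actWord-++-just⁻¹ (lowering m n) (raising m x n) e | k ℕ.<? n
... | _ , e₁ , _ | yes k<n = raising-just⇒gap {m} {x} n cols e₁ k k<n
... | _ , _  , _ | no k≮n  =
  ℤP.≤-trans (α-above x bounded (ℕP.≮⇒≥ k≮n)) (ℤP.i≤j⇒0≤j-i (hasColumns-antitone cols k))

module BracketDefined {m n : ℕ} {x : Word}
  (m-large : ∀ k → - (α k x + w k x) ≤ℤ + m) (bounded : All (λ a → index a ≤ n) x)
  {L : List ℕ} {g : ℕ → ℤ} (cols : HasColumns L g) (adm : Admissible x g) where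

  sum-antitone : ∀ k → g (suc k) + w (suc k) x ≤ℤ g k + w k x
  sum-antitone k = diff-≤-gap⇒sum-antitone g (λ i → w i x) k (ℤP.≤-trans (w-diff≤α k x) (adm k))

  block-defined : ∀ j {L₁} → HasColumns L₁ (λ i → g i + w i (raising m x j)) →
                  ∃ λ L₂ → actWord (block m x j) L₁ ≡ just L₂
  block-defined j cols₁ with replicate-bar-defined (∣ α j x ∣) j cols₁ bars-room
    where
    bars-room : (g (suc j) + w (suc j) (raising m x j)) + + ∣ α j x ∣ ≤ℤ g j + w j (raising m x j)
    bars-room rewrite w-raising-≥ m x j (ℕP.n≤1+n j) | w-raising-≥ m x j (ℕP.≤-refl {j}) | +∣α∣ j x =
      ≤-by-slack (adm j) (regroup (g j) (g (suc j)) (α j x))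
      where
      regroup : ∀ c₀ c₁ a → (c₀ - c₁) - a ≡ (c₀ + 0ℤ) - ((c₁ + 0ℤ) + a)
      regroup = solve-∀
  ... | L₂ , e₂ with replicate-num-defined (∣ β m j x ∣) j
                       (actWord-hasColumns (replicate (∣ α j x ∣) (bar j)) cols₁ e₂) nums-room
    where
    nums-room : ∀ j′ → j ≡ suc j′ →
                (g j + w j (raising m x j)) + w j (replicate (∣ α j x ∣) (bar j)) + + ∣ β m j x ∣
                ≤ℤ (g j′ + w j′ (raising m x j)) + w j′ (replicate (∣ α j x ∣) (bar j))
    nums-room j′ refl
      rewrite w-raising-≥ m x (suc j′) (ℕP.≤-refl {suc j′}) | w-replicate-bar-≡ (∣ α (suc j′) x ∣) (suc j′)
            | w-raising-< x m-large (suc j′) (ℕP.n<1+n j′) | w-replicate-bar-≢ (∣ α (suc j′) x ∣) (ℕP.1+n≢n {j′})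
            | +∣β∣ (suc j′) x (m-large (suc j′)) | +∣α∣ (suc j′) x =
      ≤-by-slack (sum-antitone j′) (regroup (g (suc j′)) (w (suc j′) x) (g j′) (w j′ x) (α (suc j′) x) (+ m))
      where
      regroup : ∀ c₁ u₁ c₀ u₀ a v →
                (c₀ + u₀) - (c₁ + u₁) ≡ ((c₀ + (u₀ + v)) + 0ℤ) - (((c₁ + 0ℤ) + - a) + (a + u₁ + v))
      regroup = solve-∀
  ... | L₃ , e₃ =
    L₃ , actWord-++-just (replicate (∣ β m j x ∣) (num j)) (replicate (∣ α j x ∣) (bar j)) e₂ e₃

  raising-defined : ∀ j → ∃ λ L₁ → actWord (raising m x j) L ≡ just L₁
  raising-defined zero = L , refl
  raising-defined (suc j) with raising-defined j
  ... | L₁ , e₁ with block-defined j (actWord-hasColumns (raising m x j) cols e₁)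
  ...   | L₂ , e₂ = L₂ , actWord-++-just (block m x j) (raising m x j) e₁ e₂

  -- Before lowering m j acts, the first j columns exceed their final values g + w x by m.
  lowering-defined : ∀ j {L₁} → HasColumns L₁ (λ i → g i + w i x - w i (lowering m j)) →
                     ∃ λ L' → actWord (lowering m j) L₁ ≡ just L'
  lowering-defined zero    _ = _ , refl
  lowering-defined (suc j) {L₁} cols₁ with replicate-bar-defined m j cols₁ bars-room
    where
    bars-room : (g (suc j) + w (suc j) x - w (suc j) (lowering m (suc j))) + + m
                ≤ℤ g j + w j x - w j (lowering m (suc j))
    bars-room rewrite w-lowering-≥ m (suc j) (ℕP.≤-refl {suc j}) | w-lowering-< m (suc j) (ℕP.n<1+n j) =
      ≤-by-slack (sum-antitone j) (regroup (g (suc j)) (w (suc j) x) (g j) (w j x) (+ m))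
      where
      regroup : ∀ c₁ u₁ c₀ u₀ v → (c₀ + u₀) - (c₁ + u₁) ≡ (c₀ + u₀ - - v) - ((c₁ + u₁ - 0ℤ) + v)
      regroup = solve-∀
  ... | L₂ , e₂ with lowering-defined j (hasColumns-cong lowered
                       (actWord-hasColumns (replicate m (bar j)) cols₁ e₂))
    where
    lowered : ∀ i → (g i + w i x - w i (lowering m (suc j))) + w i (replicate m (bar j))
                    ≡ g i + w i x - w i (lowering m j)
    lowered i rewrite lowering-suc m j | w-++ i (lowering m j) (replicate m (bar j)) =
      cancel (g i + w i x) (w i (lowering m j)) (w i (replicate m (bar j)))
      where
      cancel : ∀ a p q → (a - (p + q)) + q ≡ a - p
      cancel = solve-∀
  ... | L' , e = L' , subst (λ y → actWord y L₁ ≡ just L') (sym (lowering-suc m j))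
                       (actWord-++-just (lowering m j) (replicate m (bar j)) e₂ e)

  bracket-defined : ∃ λ L' → actWord (bracket m n x) L ≡ just L'
  bracket-defined with raising-defined n
  ... | L₁ , e₁ with lowering-defined n (hasColumns-cong handover (actWord-hasColumns (raising m x n) cols e₁))
    where
    handover : ∀ i → g i + w i (raising m x n) ≡ g i + w i x - w i (lowering m n)
    handover i rewrite sym (w-bracket x m-large bounded i) | w-++ i (lowering m n) (raising m x n) =
      cancel (g i) (w i (lowering m n)) (w i (raising m x n))
      where
      cancel : ∀ c p q → c + q ≡ c + (p + q) - p
      cancel = solve-∀
  ...   | L' , e = L' , actWord-++-just (lowering m n) (raising m x n) e₁ e

actWord-just⇒bracket-just : ∀ {x m n L L'} →
                            (∀ k → - (α k x + w k x) ≤ℤ + m) → All (λ a → index a ≤ n) x →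
                            IsPartition L → actWord x L ≡ just L' → actWord (bracket m n x) L ≡ just L'
actWord-just⇒bracket-just {x} {m} {n} {L} m-large bounded p e
  with BracketDefined.bracket-defined m-large bounded (partition-hasColumns p)
         (actWord-just⇒admissible x (partition-hasColumns p) e)
... | L″ , e″ = trans e″ (cong just (hasColumns-unique cols″ (actWord-hasColumns x (partition-hasColumns p) e)))
  where
  cols″ : HasColumns L″ (λ i → columns L i + w i x)
  cols″ = hasColumns-cong (λ i → cong (_+_ (columns L i)) (w-bracket x m-large bounded i))
                          (actWord-hasColumns (bracket m n x) (partition-hasColumns p) e″)

proposition3p4 : (x : Word) (m n : ℕ)
    → (∀ k → - (α k x ℤ.+ w k x) ℤ.≤ + m)
    → All (λ a → index a ≤ n) x
    → ∀ (L : List ℕ) → IsPartition L → actWord x L ≡ actWord (bracket m n x) L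
proposition3p4 x m n m-large bounded L p with actWord x L in e
... | just _  = sym (actWord-just⇒bracket-just m-large bounded p e)
... | nothing with actWord (bracket m n x) L in e″
...   | nothing = refl
...   | just _ with admissible⇒actWord-defined x (partition-hasColumns p)
                      (bracket-just⇒admissible bounded (partition-hasColumns p) e″)
...     | _ , e′ with trans (sym e) e′
...       | ()
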